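{- For a pure simplicial complex $\Delta$ the following are equivalent: (a) $\Delta$ is strongly shellable. (b) There is a linear order $\succ$ on $\mathcal{F}(\Delta)$ such that for each pair $F\succ G$ of facets there is a chain of facets $F=H_0,\dots,H_t=G$ with $t=\operatorname{dis}(F,G)$, all $H_l\succcurlyeq G$, and $\operatorname{dis}(H_{l-1},H_l)=1$ for $1\le l\le t$. (c) There is a linear order $\succ$ on $\mathcal{F}(\Delta)$ such that for each pair $F\succ G$ of facets there is a chain of facets $F=H_0,\dots,H_t=G$ with $t=\operatorname{dis}(F,G)$, all $H_l\succcurlyeq G$, and $\operatorname{dis}(H_{l_1},H_{l_2})=l_2-l_1$ for $0\le l_1\le l_2\le t$. (d) There is a linear order $\succ$ on $\mathcal{F}(\Delta)$ such that for each pair $F\succ G$ of facets, either $\operatorname{dis}(F,G)=1$, or $\operatorname{dis}(F,G)\ge 2$ and there exists a facet $H\succ G$ with $H\ne F$ and $\operatorname{dis}(F,H)+\operatorname{dis}(H,G)=\operatorname{dis}(F,G)$. (e) There is a linear order $\succ$ on $\mathcal{F}(\Delta)$ such that for each pair $F\succ G$ of facets, either $\operatorname{dis}(F,G)=1$, or $\operatorname{dis}(F,G)\ge 2$ and there exists a facet $H\succ G$ with $H\ne F$ and $F\cap G\subseteq H\subseteq F\cup G$.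
   Context: A simplicial complex is a finite family of subsets of a vertex set closed under taking subsets; $\mathcal{F}(\Delta)$ is its set of facets; $\Delta$ is pure if all facets have the same cardinality. A linear order $F_1,\dots,F_t$ of $\mathcal{F}(\Delta)$ ($F_i\succ F_j$ iff $i<j$) is a strong shelling order if for every $1\le i<j\le t$ there exists $k$ with $1\le k<j$ such that $|F_j\setminus F_k|=1$, $F_j\setminus F_k\subseteq F_j\setminus F_i$, and $F_k\setminus F_j\subseteq F_i$; $\Delta$ is strongly shellable if such an order exists. For facets $F,G$ of a pure complex, $\operatorname{dis}(F,G)=|F\setminus G|$. -}

module Defs where

open import Data.Nat using (ℕ; _+_; _∸_; _≤_)
open import Data.Fin using (Fin; zero; suc; toℕ; fromℕ; inject₁) renaming (_<_ to _<ᶠ_; _≤_ to _≤ᶠ_)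
open import Data.Fin.Subset using (Subset; _⊆_; _∩_; _∪_; _─_; ∣_∣)
open import Data.List using (List; length; lookup)
open import Data.Product using (Σ; ∃; ∃-syntax; _×_)
open import Data.Sum using (_⊎_)
open import Relation.Nullary using (¬_; Dec)
open import Relation.Binary.PropositionalEquality using (_≡_; _≢_)

-- A simplicial complex on the vertex set Fin n: a (decidable) family of
-- subsets of Fin n closed under taking subsets.  Finiteness is automatic.
record Complex (n : ℕ) : Set₁ where
  field
    face   : Subset n → Set
    face?  : (F : Subset n) → Dec (face F)
    closed : ∀ {F G} → G ⊆ F → face F → face G
open Complex public

Facet : ∀ {n} → Complex n → Subset n → Set
Facet Δ F = face Δ F × (∀ G → face Δ G → F ⊆ G → G ≡ F)

Pure : ∀ {n} → Complex n → Set
Pure Δ = ∀ F G → Facet Δ F → Facet Δ G → ∣ F ∣ ≡ ∣ G ∣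

dis : ∀ {n} → Subset n → Subset n → ℕ
dis F G = ∣ F ─ G ∣

-- A linear order on F(Δ), given as an enumeration F_1, ..., F_t
-- (the list L) of all facets, each exactly once; F_i ≻ F_j iff i < j.
FacetOrder : ∀ {n} → Complex n → List (Subset n) → Set
FacetOrder Δ L =
  (∀ i → Facet Δ (lookup L i)) ×
  (∀ F → Facet Δ F → ∃[ i ] lookup L i ≡ F) ×
  (∀ i j → lookup L i ≡ lookup L j → i ≡ j)

_≻[_]_ : ∀ {n} → Subset n → List (Subset n) → Subset n → Set
F ≻[ L ] G = ∃[ i ] ∃[ j ] (i <ᶠ j × lookup L i ≡ F × lookup L j ≡ G)

_≽[_]_ : ∀ {n} → Subset n → List (Subset n) → Subset n → Set
F ≽[ L ] G = F ≡ G ⊎ F ≻[ L ] G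

StrongShellingOrder : ∀ {n} → Complex n → List (Subset n) → Set
StrongShellingOrder Δ L =
  FacetOrder Δ L ×
  (∀ i j → i <ᶠ j → ∃[ k ] (k <ᶠ j ×
     ∣ lookup L j ─ lookup L k ∣ ≡ 1 ×
     (lookup L j ─ lookup L k) ⊆ (lookup L j ─ lookup L i) ×
     (lookup L k ─ lookup L j) ⊆ lookup L i))

StronglyShellable : ∀ {n} → Complex n → Set
StronglyShellable Δ = ∃[ L ] StrongShellingOrder Δ L

ChainBase : ∀ {n} → Complex n → List (Subset n) → (F G : Subset n)
          → (Fin (Data.Nat.suc (dis F G)) → Subset n) → Set
ChainBase Δ L F G H =
  H zero ≡ F × H (fromℕ (dis F G)) ≡ G ×
  (∀ l → Facet Δ (H l)) × (∀ l → H l ≽[ L ] G)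

CondB : ∀ {n} → Complex n → Set
CondB Δ = ∃[ L ] (FacetOrder Δ L × (∀ F G → F ≻[ L ] G →
  ∃[ H ] (ChainBase Δ L F G H ×
    (∀ (l : Fin (dis F G)) → dis (H (inject₁ l)) (H (suc l)) ≡ 1))))

CondC : ∀ {n} → Complex n → Set
CondC Δ = ∃[ L ] (FacetOrder Δ L × (∀ F G → F ≻[ L ] G →
  ∃[ H ] (ChainBase Δ L F G H ×
    (∀ l₁ l₂ → l₁ ≤ᶠ l₂ → dis (H l₁) (H l₂) ≡ toℕ l₂ ∸ toℕ l₁))))

CondD : ∀ {n} → Complex n → Set
CondD Δ = ∃[ L ] (FacetOrder Δ L × (∀ F G → F ≻[ L ] G →
  dis F G ≡ 1 ⊎
  (2 ≤ dis F G × ∃[ H ] (H ≻[ L ] G × H ≢ F × dis F H + dis H G ≡ dis F G))))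

CondE : ∀ {n} → Complex n → Set
CondE Δ = ∃[ L ] (FacetOrder Δ L × (∀ F G → F ≻[ L ] G →
  dis F G ≡ 1 ⊎
  (2 ≤ dis F G × ∃[ H ] (H ≻[ L ] G × H ≢ F × (F ∩ G) ⊆ H × H ⊆ (F ∪ G)))))

module Submission where

-- For facets of a pure complex, dis is a metric, and dis F H + dis H G = dis F G holds exactly
-- when H agrees with F and G wherever they agree, i.e. F ∩ G ⊆ H ⊆ F ∪ G.  In this language a
-- strong shelling order says: whenever F ≻ G, some K ≻ G adjacent to G lies between F and G.
-- By induction on dis F G this yields geodesic chains from F to G above G, giving (c), and
-- (c) ⇒ (b) ⇒ (d) ⇒ (e) are immediate.  Conversely (e) lets one walk from F towards G, staying
-- between them and above G, until reaching a neighbour of G: the shelling witness.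

open import Defs
open import Data.Bool using (Bool; true; false; _∧_; _∨_)
open import Data.Fin using (Fin; zero; suc; toℕ; fromℕ; inject₁)
import Data.Fin as Fin
import Data.Fin.Properties as Finₚ
open import Data.Fin.Subset using (Subset; _⊆_; _∩_; _∪_; _─_; ∣_∣)
open import Data.Fin.Subset.Properties using (drop-∷-⊆; in⊆in; out⊆; ⊆-antisym)
open import Data.List using (List; lookup)
open import Data.Nat using (ℕ; zero; suc; _+_; _∸_; _≤_; _<_; z≤n; s≤s; _≤?_)
open import Data.Nat.Properties
open import Data.Product using (Σ-syntax; ∃-syntax; _×_; _,_; proj₁; proj₂)
open import Data.Sum using (_⊎_; inj₁; inj₂)
open import Data.Unit using (⊤; tt)
open import Data.Vec using (_∷_; []; here; there)
open import Function.Base using (_∘_)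
open import Function.Bundles using (_⇔_; mk⇔)
open import Relation.Binary.Definitions using (tri<; tri≈; tri>)
open import Relation.Binary.PropositionalEquality
open import Relation.Nullary using (yes; no; contradiction)

dis-refl : ∀ {n} (F : Subset n) → dis F F ≡ 0
dis-refl []          = refl
dis-refl (true ∷ F)  = dis-refl F
dis-refl (false ∷ F) = dis-refl F

dis≡suc⇒≢ : ∀ {n m} (F G : Subset n) → dis F G ≡ suc m → F ≢ G
dis≡suc⇒≢ F _ d refl = 1+n≢0 (trans (sym d) (dis-refl F))

dis≡0⇒⊆ : ∀ {n} (F G : Subset n) → dis F G ≡ 0 → F ⊆ G
dis≡0⇒⊆ []          []          _ = λ ()
dis≡0⇒⊆ (true ∷ F)  (true ∷ G)  d = in⊆in (dis≡0⇒⊆ F G d)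
dis≡0⇒⊆ (false ∷ F) (true ∷ G)  d = out⊆ (dis≡0⇒⊆ F G d)
dis≡0⇒⊆ (false ∷ F) (false ∷ G) d = out⊆ (dis≡0⇒⊆ F G d)

∣F∣+dis[G,F]≡∣G∣+dis[F,G] : ∀ {n} (F G : Subset n) → ∣ F ∣ + dis G F ≡ ∣ G ∣ + dis F G
∣F∣+dis[G,F]≡∣G∣+dis[F,G] []          []          = refl
∣F∣+dis[G,F]≡∣G∣+dis[F,G] (true ∷ F)  (true ∷ G)  = cong suc (∣F∣+dis[G,F]≡∣G∣+dis[F,G] F G)
∣F∣+dis[G,F]≡∣G∣+dis[F,G] (true ∷ F)  (false ∷ G) =
  trans (cong suc (∣F∣+dis[G,F]≡∣G∣+dis[F,G] F G)) (sym (+-suc ∣ G ∣ (dis F G)))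
∣F∣+dis[G,F]≡∣G∣+dis[F,G] (false ∷ F) (true ∷ G)  =
  trans (+-suc ∣ F ∣ (dis G F)) (cong suc (∣F∣+dis[G,F]≡∣G∣+dis[F,G] F G))
∣F∣+dis[G,F]≡∣G∣+dis[F,G] (false ∷ F) (false ∷ G) = ∣F∣+dis[G,F]≡∣G∣+dis[F,G] F G

dis-sym : ∀ {n} (F G : Subset n) → ∣ F ∣ ≡ ∣ G ∣ → dis F G ≡ dis G F
dis-sym F G ∣F∣≡∣G∣ = +-cancelˡ-≡ ∣ F ∣ (dis F G) (dis G F) (begin
  ∣ F ∣ + dis F G ≡⟨ cong (_+ dis F G) ∣F∣≡∣G∣ ⟩
  ∣ G ∣ + dis F G ≡⟨ ∣F∣+dis[G,F]≡∣G∣+dis[F,G] F G ⟨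
  ∣ F ∣ + dis G F ∎)
  where open ≡-Reasoning

dis≡0⇒≡ : ∀ {n} {F G : Subset n} → ∣ F ∣ ≡ ∣ G ∣ → dis F G ≡ 0 → F ≡ G
dis≡0⇒≡ {F = F} {G} ∣F∣≡∣G∣ d =
  ⊆-antisym (dis≡0⇒⊆ F G d) (dis≡0⇒⊆ G F (trans (sym (dis-sym F G ∣F∣≡∣G∣)) d))

dis-triangle : ∀ {n} (F H G : Subset n) → dis F G ≤ dis F H + dis H G
dis-triangle []          []          []          = z≤n
dis-triangle (true ∷ F)  (true ∷ H)  (true ∷ G)  = dis-triangle F H G
dis-triangle (true ∷ F)  (true ∷ H)  (false ∷ G) =
  ≤-trans (s≤s (dis-triangle F H G)) (≤-reflexive (sym (+-suc (dis F H) (dis H G))))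
dis-triangle (true ∷ F)  (false ∷ H) (true ∷ G)  = m≤n⇒m≤1+n (dis-triangle F H G)
dis-triangle (true ∷ F)  (false ∷ H) (false ∷ G) = s≤s (dis-triangle F H G)
dis-triangle (false ∷ F) (true ∷ H)  (true ∷ G)  = dis-triangle F H G
dis-triangle (false ∷ F) (true ∷ H)  (false ∷ G) =
  ≤-trans (dis-triangle F H G) (≤-trans (n≤1+n _) (≤-reflexive (sym (+-suc (dis F H) (dis H G)))))
dis-triangle (false ∷ F) (false ∷ H) (true ∷ G)  = dis-triangle F H G
dis-triangle (false ∷ F) (false ∷ H) (false ∷ G) = dis-triangle F H G

Between₁ : Bool → Bool → Bool → Set
Between₁ true  h true  = h ≡ true
Between₁ false h false = h ≡ false
Between₁ true  _ false = ⊤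
Between₁ false _ true  = ⊤

Between : ∀ {n} → Subset n → Subset n → Subset n → Set
Between []      []      []      = ⊤
Between (f ∷ F) (h ∷ H) (g ∷ G) = Between₁ f h g × Between F H G

Between₁-reflˡ : ∀ f g → Between₁ f f g
Between₁-reflˡ true  true  = refl
Between₁-reflˡ true  false = tt
Between₁-reflˡ false true  = tt
Between₁-reflˡ false false = refl

Between₁-sym : ∀ f h g → Between₁ f h g → Between₁ g h f
Between₁-sym true  h true  b = b
Between₁-sym false h false b = b
Between₁-sym true  h false _ = tt
Between₁-sym false h true  _ = tt

Between₁-innerTrans : ∀ f x k g → Between₁ f x g → Between₁ x k g → Between₁ f k g
Between₁-innerTrans true  .true  k true  refl b = b
Between₁-innerTrans false .false k false refl b = b
Between₁-innerTrans true  x      k false _    _ = tt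
Between₁-innerTrans false x      k true  _    _ = tt

Between-reflˡ : ∀ {n} (F G : Subset n) → Between F F G
Between-reflˡ []      []      = tt
Between-reflˡ (f ∷ F) (g ∷ G) = Between₁-reflˡ f g , Between-reflˡ F G

Between-sym : ∀ {n} (F H G : Subset n) → Between F H G → Between G H F
Between-sym []      []      []      _        = tt
Between-sym (f ∷ F) (h ∷ H) (g ∷ G) (b , bs) = Between₁-sym f h g b , Between-sym F H G bs

Between-innerTrans : ∀ {n} (F X K G : Subset n) →
                     Between F X G → Between X K G → Between F K G
Between-innerTrans []      []      []      []      _        _        = tt
Between-innerTrans (f ∷ F) (x ∷ X) (k ∷ K) (g ∷ G) (b , bs) (c , cs) =
  Between₁-innerTrans f x k g b c , Between-innerTrans F X K G bs cs

Between-innerTrans′ : ∀ {n} (F H K G : Subset n) →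
                      Between F K G → Between F H K → Between F H G
Between-innerTrans′ F H K G FKG FHK =
  Between-sym G H F
    (Between-innerTrans G K H F (Between-sym F K G FKG) (Between-sym F H K FHK))

Between⇒dis-additive : ∀ {n} (F H G : Subset n) →
                       Between F H G → dis F H + dis H G ≡ dis F G
Between⇒dis-additive []          []          []          _        = refl
Between⇒dis-additive (true ∷ F)  (true ∷ H)  (true ∷ G)  (_ , bs) = Between⇒dis-additive F H G bs
Between⇒dis-additive (true ∷ F)  (true ∷ H)  (false ∷ G) (_ , bs) =
  trans (+-suc (dis F H) (dis H G)) (cong suc (Between⇒dis-additive F H G bs))
Between⇒dis-additive (true ∷ F)  (false ∷ H) (false ∷ G) (_ , bs) =
  cong suc (Between⇒dis-additive F H G bs)
Between⇒dis-additive (false ∷ F) (true ∷ H)  (true ∷ G)  (_ , bs) = Between⇒dis-additive F H G bs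
Between⇒dis-additive (false ∷ F) (false ∷ H) (true ∷ G)  (_ , bs) = Between⇒dis-additive F H G bs
Between⇒dis-additive (false ∷ F) (false ∷ H) (false ∷ G) (_ , bs) = Between⇒dis-additive F H G bs

suc-dis-sum≢dis : ∀ {n} (F H G : Subset n) → suc (dis F H + dis H G) ≢ dis F G
suc-dis-sum≢dis F H G e = 1+n≰n (≤-trans (≤-reflexive e) (dis-triangle F H G))

dis-additive⇒Between : ∀ {n} (F H G : Subset n) →
                       dis F H + dis H G ≡ dis F G → Between F H G
dis-additive⇒Between []          []          []          _ = tt
dis-additive⇒Between (true ∷ F)  (true ∷ H)  (true ∷ G)  e = refl , dis-additive⇒Between F H G e
dis-additive⇒Between (true ∷ F)  (false ∷ H) (true ∷ G)  e = contradiction e (suc-dis-sum≢dis F H G)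
dis-additive⇒Between (true ∷ F)  (true ∷ H)  (false ∷ G) e =
  tt , dis-additive⇒Between F H G (suc-injective (trans (sym (+-suc (dis F H) (dis H G))) e))
dis-additive⇒Between (true ∷ F)  (false ∷ H) (false ∷ G) e =
  tt , dis-additive⇒Between F H G (suc-injective e)
dis-additive⇒Between (false ∷ F) (true ∷ H)  (true ∷ G)  e = tt , dis-additive⇒Between F H G e
dis-additive⇒Between (false ∷ F) (false ∷ H) (true ∷ G)  e = tt , dis-additive⇒Between F H G e
dis-additive⇒Between (false ∷ F) (true ∷ H)  (false ∷ G) e =
  contradiction (trans (sym (+-suc (dis F H) (dis H G))) e) (suc-dis-sum≢dis F H G)
dis-additive⇒Between (false ∷ F) (false ∷ H) (false ∷ G) e = refl , dis-additive⇒Between F H G e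

∷-⊆-∷ : ∀ {n b c} {p q : Subset n} → (b ≡ true → c ≡ true) → p ⊆ q → b ∷ p ⊆ c ∷ q
∷-⊆-∷ head _   here      rewrite head refl = here
∷-⊆-∷ _    p⊆q (there x) = there (p⊆q x)

∷-⊆-∷-head : ∀ {n b c} {p q : Subset n} → b ∷ p ⊆ c ∷ q → b ≡ true → c ≡ true
∷-⊆-∷-head bp⊆cq refl with bp⊆cq here
... | here = refl

Between₁⇒∧-⊆ : ∀ f h g → Between₁ f h g → f ∧ g ≡ true → h ≡ true
Between₁⇒∧-⊆ true _ true b _ = b

Between₁⇒⊆-∨ : ∀ f h g → Between₁ f h g → h ≡ true → f ∨ g ≡ true
Between₁⇒⊆-∨ true  _ _     _    _ = refl
Between₁⇒⊆-∨ false _ true  _    _ = refl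
Between₁⇒⊆-∨ false _ false refl ()

⊆⇒Between₁ : ∀ f h g → (f ∧ g ≡ true → h ≡ true) → (h ≡ true → f ∨ g ≡ true) →
             Between₁ f h g
⊆⇒Between₁ true  h     true  ∧⊆ _  = ∧⊆ refl
⊆⇒Between₁ true  h     false _  _  = tt
⊆⇒Between₁ false h     true  _  _  = tt
⊆⇒Between₁ false true  false _  ⊆∨ = contradiction (⊆∨ refl) λ ()
⊆⇒Between₁ false false false _  _  = refl

Between⇒⊆ : ∀ {n} (F H G : Subset n) → Between F H G → F ∩ G ⊆ H × H ⊆ F ∪ G
Between⇒⊆ []      []      []      _        = (λ ()) , (λ ())
Between⇒⊆ (f ∷ F) (h ∷ H) (g ∷ G) (b , bs) =
  ∷-⊆-∷ (Between₁⇒∧-⊆ f h g b) (proj₁ (Between⇒⊆ F H G bs)) ,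
  ∷-⊆-∷ (Between₁⇒⊆-∨ f h g b) (proj₂ (Between⇒⊆ F H G bs))

⊆⇒Between : ∀ {n} (F H G : Subset n) → F ∩ G ⊆ H → H ⊆ F ∪ G → Between F H G
⊆⇒Between []      []      []      _   _   = tt
⊆⇒Between (f ∷ F) (h ∷ H) (g ∷ G) ∩⊆H H⊆∪ =
  ⊆⇒Between₁ f h g (∷-⊆-∷-head ∩⊆H) (∷-⊆-∷-head H⊆∪) ,
  ⊆⇒Between F H G (drop-∷-⊆ ∩⊆H) (drop-∷-⊆ H⊆∪)

shellingInclusions⇒Between : ∀ {n} (F K G : Subset n) →
                             G ─ K ⊆ G ─ F → K ─ G ⊆ F → Between F K G
shellingInclusions⇒Between []          []          []          _ _ = tt
shellingInclusions⇒Between (true ∷ F)  (true ∷ K)  (true ∷ G)  a b =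
  refl , shellingInclusions⇒Between F K G (drop-∷-⊆ a) (drop-∷-⊆ b)
shellingInclusions⇒Between (true ∷ F)  (false ∷ K) (true ∷ G)  a _ =
  contradiction (∷-⊆-∷-head a refl) λ ()
shellingInclusions⇒Between (true ∷ F)  (k ∷ K)     (false ∷ G) a b =
  tt , shellingInclusions⇒Between F K G (drop-∷-⊆ a) (drop-∷-⊆ b)
shellingInclusions⇒Between (false ∷ F) (k ∷ K)     (true ∷ G)  a b =
  tt , shellingInclusions⇒Between F K G (drop-∷-⊆ a) (drop-∷-⊆ b)
shellingInclusions⇒Between (false ∷ F) (true ∷ K)  (false ∷ G) _ b =
  contradiction (∷-⊆-∷-head b refl) λ ()
shellingInclusions⇒Between (false ∷ F) (false ∷ K) (false ∷ G) a b =
  refl , shellingInclusions⇒Between F K G (drop-∷-⊆ a) (drop-∷-⊆ b)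

Between⇒shellingInclusions : ∀ {n} (F K G : Subset n) →
                             Between F K G → G ─ K ⊆ G ─ F × K ─ G ⊆ F
Between⇒shellingInclusions []          []          []          _        = (λ ()) , (λ ())
Between⇒shellingInclusions (true ∷ F)  (true ∷ K)  (true ∷ G)  (_ , bs) =
  ∷-⊆-∷ (λ ()) (proj₁ (Between⇒shellingInclusions F K G bs)) ,
  ∷-⊆-∷ (λ ()) (proj₂ (Between⇒shellingInclusions F K G bs))
Between⇒shellingInclusions (true ∷ F)  (true ∷ K)  (false ∷ G) (_ , bs) =
  ∷-⊆-∷ (λ ()) (proj₁ (Between⇒shellingInclusions F K G bs)) ,
  ∷-⊆-∷ (λ _ → refl) (proj₂ (Between⇒shellingInclusions F K G bs))
Between⇒shellingInclusions (true ∷ F)  (false ∷ K) (false ∷ G) (_ , bs) =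
  ∷-⊆-∷ (λ ()) (proj₁ (Between⇒shellingInclusions F K G bs)) ,
  ∷-⊆-∷ (λ ()) (proj₂ (Between⇒shellingInclusions F K G bs))
Between⇒shellingInclusions (false ∷ F) (true ∷ K)  (true ∷ G)  (_ , bs) =
  ∷-⊆-∷ (λ ()) (proj₁ (Between⇒shellingInclusions F K G bs)) ,
  ∷-⊆-∷ (λ ()) (proj₂ (Between⇒shellingInclusions F K G bs))
Between⇒shellingInclusions (false ∷ F) (false ∷ K) (true ∷ G)  (_ , bs) =
  ∷-⊆-∷ (λ _ → refl) (proj₁ (Between⇒shellingInclusions F K G bs)) ,
  ∷-⊆-∷ (λ ()) (proj₂ (Between⇒shellingInclusions F K G bs))
Between⇒shellingInclusions (false ∷ F) (false ∷ K) (false ∷ G) (_ , bs) =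
  ∷-⊆-∷ (λ ()) (proj₁ (Between⇒shellingInclusions F K G bs)) ,
  ∷-⊆-∷ (λ ()) (proj₂ (Between⇒shellingInclusions F K G bs))

dis-via-neighbour : ∀ {n m} (F K G : Subset n) →
                    Between F K G → dis K G ≡ 1 → dis F G ≡ suc m → dis F K ≡ m
dis-via-neighbour F K G FKG dKG dFG = suc-injective (begin
  1 + dis F K       ≡⟨ +-comm 1 (dis F K) ⟩
  dis F K + 1       ≡⟨ cong (dis F K +_) dKG ⟨
  dis F K + dis K G ≡⟨ Between⇒dis-additive F K G FKG ⟩
  dis F G           ≡⟨ dFG ⟩
  suc _             ∎)
  where open ≡-Reasoning

unitSteps⇒dis≤length : ∀ {n} t (H : Fin (suc t) → Subset n) →
                       (∀ l → dis (H (inject₁ l)) (H (suc l)) ≡ 1) → dis (H zero) (H (fromℕ t)) ≤ t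
unitSteps⇒dis≤length zero    H _     = ≤-reflexive (dis-refl (H zero))
unitSteps⇒dis≤length (suc t) H steps = begin
  dis H₀ Hₜ              ≤⟨ dis-triangle H₀ H₁ Hₜ ⟩
  dis H₀ H₁ + dis H₁ Hₜ  ≡⟨ cong (_+ dis H₁ Hₜ) (steps zero) ⟩
  suc (dis H₁ Hₜ)        ≤⟨ s≤s (unitSteps⇒dis≤length t (H ∘ suc) (steps ∘ suc)) ⟩
  suc t                  ∎
  where
    open ≤-Reasoning
    H₀ H₁ Hₜ : Subset _
    H₀ = H zero
    H₁ = H (suc zero)
    Hₜ = H (fromℕ (suc t))

geodesic⇒unitSteps : ∀ {n t} (H : Fin (suc t) → Subset n) →
                     (∀ l₁ l₂ → l₁ Fin.≤ l₂ → dis (H l₁) (H l₂) ≡ toℕ l₂ ∸ toℕ l₁) →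
                     ∀ l → dis (H (inject₁ l)) (H (suc l)) ≡ 1
geodesic⇒unitSteps H geodesic l = begin
  dis (H (inject₁ l)) (H (suc l)) ≡⟨ geodesic (inject₁ l) (suc l) inject₁≤suc ⟩
  suc (toℕ l) ∸ toℕ (inject₁ l)   ≡⟨ cong (suc (toℕ l) ∸_) (Finₚ.toℕ-inject₁ l) ⟩
  suc (toℕ l) ∸ toℕ l             ≡⟨ m+n∸n≡m 1 (toℕ l) ⟩
  1                               ∎
  where
    open ≡-Reasoning
    inject₁≤suc : toℕ (inject₁ l) ≤ suc (toℕ l)
    inject₁≤suc = m≤n⇒m≤1+n (≤-reflexive (Finₚ.toℕ-inject₁ l))

[m∸a]∸[m∸b]≡b∸a : ∀ {a b m} → a ≤ b → b ≤ m → (m ∸ a) ∸ (m ∸ b) ≡ b ∸ a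
[m∸a]∸[m∸b]≡b∸a {zero}                z≤n       b≤m       = m∸[m∸n]≡n b≤m
[m∸a]∸[m∸b]≡b∸a {suc a} {suc b} {suc m} (s≤s a≤b) (s≤s b≤m) = [m∸a]∸[m∸b]≡b∸a a≤b b≤m

snoc : ∀ {A : Set} → ℕ → (ℕ → A) → A → ℕ → A
snoc m h x a with a ≤? m
... | yes _ = h a
... | no  _ = x

snoc-≤ : ∀ {A : Set} {m a} (h : ℕ → A) (x : A) → a ≤ m → snoc m h x a ≡ h a
snoc-≤ {m = m} {a} h x a≤m with a ≤? m
... | yes _   = refl
... | no  a≰m = contradiction a≤m a≰m

snoc-suc : ∀ {A : Set} m (h : ℕ → A) (x : A) → snoc m h x (suc m) ≡ x
snoc-suc m h x with suc m ≤? m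
... | yes 1+m≤m = contradiction 1+m≤m 1+n≰n
... | no  _     = refl

module PureComplex {n : ℕ} (Δ : Complex n) (pure : Pure Δ) where

  dis-symᶠ : ∀ {F G} → Facet Δ F → Facet Δ G → dis F G ≡ dis G F
  dis-symᶠ {F} {G} fF fG = dis-sym F G (pure F G fF fG)

  dis≡0⇒≡ᶠ : ∀ {F G} → Facet Δ F → Facet Δ G → dis F G ≡ 0 → F ≡ G
  dis≡0⇒≡ᶠ {F} {G} fF fG = dis≡0⇒≡ (pure F G fF fG)

  Between⇒dis<ᶠ : ∀ {F X G} → Facet Δ F → Facet Δ X → X ≢ F → Between F X G → dis X G < dis F G
  Between⇒dis<ᶠ {F} {X} {G} fF fX X≢F FXG = subst (dis X G <_) (Between⇒dis-additive F X G FXG)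
    (m<n+m (dis X G) (n≢0⇒n>0 (λ dFX≡0 → X≢F (sym (dis≡0⇒≡ᶠ fF fX dFX≡0)))))

  -- Indexed by ℕ for convenience: only h 0, …, h m are constrained.
  record Geodesic (F G : Subset n) (m : ℕ) (h : ℕ → Subset n) : Set where
    field
      start : h 0 ≡ F
      end   : h m ≡ G
      facet : ∀ a → a ≤ m → Facet Δ (h a)
      dis-h : ∀ a b → a ≤ b → b ≤ m → dis (h a) (h b) ≡ b ∸ a

    dis-start : ∀ a → a ≤ m → dis F (h a) ≡ a
    dis-start a a≤m = subst (λ X → dis X (h a) ≡ a) start (dis-h 0 a z≤n a≤m)

    dis-end : ∀ a → a ≤ m → dis (h a) G ≡ m ∸ a
    dis-end a a≤m = subst (λ X → dis (h a) X ≡ m ∸ a) end (dis-h a m a≤m ≤-refl)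

    dis-ends : dis F G ≡ m
    dis-ends = subst (λ X → dis F X ≡ m) end (dis-start m ≤-refl)

    between : ∀ a → a ≤ m → Between F (h a) G
    between a a≤m = dis-additive⇒Between F (h a) G (begin
      dis F (h a) + dis (h a) G ≡⟨ cong₂ _+_ (dis-start a a≤m) (dis-end a a≤m) ⟩
      a + (m ∸ a)               ≡⟨ m+[n∸m]≡n a≤m ⟩
      m                         ≡⟨ dis-ends ⟨
      dis F G                   ∎)
      where open ≡-Reasoning

  open Geodesic

  Geodesic-refl : ∀ {F} → Facet Δ F → Geodesic F F 0 (λ _ → F)
  Geodesic-refl {F} fF = record
    { start = refl
    ; end   = refl
    ; facet = λ _ _ → fF
    ; dis-h = λ { _ _ z≤n z≤n → dis-refl F }
    }

  Geodesic-reverse : ∀ {F G m h} → Geodesic G F m h → Geodesic F G m (λ a → h (m ∸ a))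
  Geodesic-reverse {m = m} {h} γ = record
    { start = end γ
    ; end   = trans (cong h (n∸n≡0 m)) (start γ)
    ; facet = λ a _ → facet′ a
    ; dis-h = λ a b a≤b b≤m → begin
        dis (h (m ∸ a)) (h (m ∸ b)) ≡⟨ dis-symᶠ (facet′ a) (facet′ b) ⟩
        dis (h (m ∸ b)) (h (m ∸ a)) ≡⟨ dis-h γ (m ∸ b) (m ∸ a) (∸-monoʳ-≤ m a≤b) (m∸n≤m m a) ⟩
        (m ∸ a) ∸ (m ∸ b)           ≡⟨ [m∸a]∸[m∸b]≡b∸a a≤b b≤m ⟩
        b ∸ a                       ∎
    }
    where
      open ≡-Reasoning
      facet′ : ∀ a → Facet Δ (h (m ∸ a))
      facet′ a = facet γ (m ∸ a) (m∸n≤m m a)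

  Geodesic-snoc : ∀ {F K G m h} → Geodesic F K m h → Facet Δ G → dis K G ≡ 1 → Between F K G →
                  Geodesic F G (suc m) (snoc m h G)
  Geodesic-snoc {F} {K} {G} {m} {h} γ fG dKG FKG = record
    { start = trans (snoc-≤ {m = m} h G z≤n) (start γ)
    ; end   = snoc-suc m h G
    ; facet = facet′
    ; dis-h = dis-h′
    }
    where
      open ≡-Reasoning

      dis-to-G : ∀ a → a ≤ m → dis (h a) G ≡ suc m ∸ a
      dis-to-G a a≤m = trans (sym (m+n∸m≡n a (dis (h a) G))) (cong (_∸ a) (begin
        a + dis (h a) G           ≡⟨ cong (_+ dis (h a) G) (dis-start γ a a≤m) ⟨
        dis F (h a) + dis (h a) G ≡⟨ Between⇒dis-additive F (h a) G
                                       (Between-innerTrans′ F (h a) K G FKG (between γ a a≤m)) ⟩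
        dis F G                   ≡⟨ Between⇒dis-additive F K G FKG ⟨
        dis F K + dis K G         ≡⟨ cong₂ _+_ (dis-ends γ) dKG ⟩
        m + 1                     ≡⟨ +-comm m 1 ⟩
        suc m                     ∎))

      facet′ : ∀ a → a ≤ suc m → Facet Δ (snoc m h G a)
      facet′ a a≤1+m with m≤n⇒m<n∨m≡n a≤1+m
      ... | inj₁ a<1+m rewrite snoc-≤ h G (≤-pred a<1+m) = facet γ a (≤-pred a<1+m)
      ... | inj₂ refl  rewrite snoc-suc m h G             = fG

      dis-h′ : ∀ a b → a ≤ b → b ≤ suc m → dis (snoc m h G a) (snoc m h G b) ≡ b ∸ a
      dis-h′ a b a≤b b≤1+m with m≤n⇒m<n∨m≡n b≤1+m
      ... | inj₁ b<1+m
            rewrite snoc-≤ h G (≤-trans a≤b (≤-pred b<1+m)) | snoc-≤ h G (≤-pred b<1+m)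
            = dis-h γ a b a≤b (≤-pred b<1+m)
      ... | inj₂ refl with m≤n⇒m<n∨m≡n a≤b
      ...   | inj₁ a<1+m rewrite snoc-≤ h G (≤-pred a<1+m) | snoc-suc m h G = dis-to-G a (≤-pred a<1+m)
      ...   | inj₂ refl  rewrite snoc-suc m h G = trans (dis-refl G) (sym (n∸n≡0 m))

  module Ordered (L : List (Subset n)) (fo : FacetOrder Δ L) where

    private
      facetAt : ∀ i → Facet Δ (lookup L i)
      facetAt = proj₁ fo

      listed : ∀ F → Facet Δ F → ∃[ i ] lookup L i ≡ F
      listed = proj₁ (proj₂ fo)

      injective : ∀ i j → lookup L i ≡ lookup L j → i ≡ j
      injective = proj₂ (proj₂ fo)

    ≻-facetˡ : ∀ {F G} → F ≻[ L ] G → Facet Δ F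
    ≻-facetˡ (i , _ , _ , refl , _) = facetAt i

    ≻-facetʳ : ∀ {F G} → F ≻[ L ] G → Facet Δ G
    ≻-facetʳ (_ , j , _ , _ , refl) = facetAt j

    ≻-trans : ∀ {F G H} → F ≻[ L ] G → G ≻[ L ] H → F ≻[ L ] H
    ≻-trans (i , j , i<j , F≡ , G≡) (j′ , k , j′<k , G≡′ , H≡)
      with injective j j′ (trans G≡ (sym G≡′))
    ... | refl = i , k , Finₚ.<-trans i<j j′<k , F≡ , H≡

    ≽-≻-trans : ∀ {F G H} → F ≽[ L ] G → G ≻[ L ] H → F ≻[ L ] H
    ≽-≻-trans (inj₁ refl) G≻H = G≻H
    ≽-≻-trans (inj₂ F≻G)  G≻H = ≻-trans F≻G G≻H

    ≻⇒≢ : ∀ {F G} → F ≻[ L ] G → F ≢ G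
    ≻⇒≢ (i , j , i<j , refl , G≡) refl = Finₚ.<-irrefl (injective i j (sym G≡)) i<j

    ≻⇒dis≢0 : ∀ {F G} → F ≻[ L ] G → dis F G ≢ 0
    ≻⇒dis≢0 F≻G = ≻⇒≢ F≻G ∘ dis≡0⇒≡ᶠ (≻-facetˡ F≻G) (≻-facetʳ F≻G)

    ≻-trichotomy : ∀ {F G} → Facet Δ F → Facet Δ G → F ≻[ L ] G ⊎ F ≡ G ⊎ G ≻[ L ] F
    ≻-trichotomy {F} {G} fF fG with listed F fF | listed G fG
    ... | i , refl | j , refl with Finₚ.<-cmp i j
    ...   | tri< i<j _ _ = inj₁ (i , j , i<j , refl , refl)
    ...   | tri≈ _ i≡j _ = inj₂ (inj₁ (cong (lookup L) i≡j))
    ...   | tri> _ _ j<i = inj₂ (inj₂ (j , i , j<i , refl , refl))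

    NeighbourBetween : Subset n → Subset n → Set
    NeighbourBetween F G = ∃[ K ] (K ≻[ L ] G × dis K G ≡ 1 × Between F K G)

    HasNeighboursBetween : Set
    HasNeighboursBetween = ∀ F G → F ≻[ L ] G → NeighbourBetween F G

    strongShelling⇒neighbours : StrongShellingOrder Δ L → HasNeighboursBetween
    strongShelling⇒neighbours (_ , shelling) _ _ (i , j , i<j , refl , refl) with shelling i j i<j
    ... | k , k<j , ∣Fj─Fk∣≡1 , Fj─Fk⊆Fj─Fi , Fk─Fj⊆Fi =
      lookup L k , (k , j , k<j , refl , refl) ,
      trans (dis-symᶠ (facetAt k) (facetAt j)) ∣Fj─Fk∣≡1 ,
      shellingInclusions⇒Between (lookup L i) (lookup L k) (lookup L j) Fj─Fk⊆Fj─Fi Fk─Fj⊆Fi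

    neighbours⇒strongShelling : HasNeighboursBetween → StrongShellingOrder Δ L
    neighbours⇒strongShelling neighbours = fo , shelling
      where
        shelling : ∀ i j → i Fin.< j → ∃[ k ] (k Fin.< j ×
                     ∣ lookup L j ─ lookup L k ∣ ≡ 1 ×
                     lookup L j ─ lookup L k ⊆ lookup L j ─ lookup L i ×
                     lookup L k ─ lookup L j ⊆ lookup L i)
        shelling i j i<j with neighbours _ _ (i , j , i<j , refl , refl)
        ... | _ , (k , j′ , k<j′ , refl , Fj′≡Fj) , dKG , FKG with injective j′ j Fj′≡Fj
        ...   | refl = k , k<j′ , trans (dis-symᶠ (facetAt j′) (facetAt k)) dKG ,
                       Between⇒shellingInclusions (lookup L i) (lookup L k) (lookup L j′) FKG

    GeodesicAbove : Subset n → Subset n → ℕ → Set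
    GeodesicAbove F G m =
      Σ[ h ∈ (ℕ → Subset n) ] (Geodesic F G m h × (∀ a → a ≤ m → h a ≽[ L ] G))

    GeodesicAbove-snoc : ∀ {F K G m h} → Geodesic F K m h → (∀ a → a ≤ m → h a ≻[ L ] G) →
                         K ≻[ L ] G → dis K G ≡ 1 → Between F K G → GeodesicAbove F G (suc m)
    GeodesicAbove-snoc {G = G} {m} {h} γ above K≻G dKG FKG =
      snoc m h G , Geodesic-snoc γ (≻-facetʳ K≻G) dKG FKG , above′
      where
        above′ : ∀ a → a ≤ suc m → snoc m h G a ≽[ L ] G
        above′ a a≤1+m with m≤n⇒m<n∨m≡n a≤1+m
        ... | inj₁ a<1+m rewrite snoc-≤ h G (≤-pred a<1+m) = inj₂ (above a (≤-pred a<1+m))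
        ... | inj₂ refl  rewrite snoc-suc m h G             = inj₁ refl

    -- By induction, F and the neighbour K are joined by a geodesic above the lower of the two,
    -- hence above G, which then extends by the step K → G.
    neighbours⇒geodesicAbove : HasNeighboursBetween →
                               ∀ m {F G} → F ≻[ L ] G → dis F G ≡ m → GeodesicAbove F G m
    neighbours⇒geodesicAbove _ zero F≻G dFG = contradiction dFG (≻⇒dis≢0 F≻G)
    neighbours⇒geodesicAbove neighbours (suc m) {F} {G} F≻G dFG with neighbours F G F≻G
    ... | K , K≻G , dKG , FKG with ≻-trichotomy (≻-facetˡ F≻G) (≻-facetˡ K≻G)
    ...   | inj₁ F≻K with neighbours⇒geodesicAbove neighbours m F≻K (dis-via-neighbour F K G FKG dKG dFG)
    ...     | h , γ , above =
              GeodesicAbove-snoc γ (λ a a≤m → ≽-≻-trans (above a a≤m) K≻G) K≻G dKG FKG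
    neighbours⇒geodesicAbove neighbours (suc m) {F} {G} F≻G dFG
        | K , K≻G , dKG , FKG | inj₂ (inj₁ refl) =
      GeodesicAbove-snoc γ (λ _ _ → F≻G) K≻G dKG FKG
      where
        γ : Geodesic F F m (λ _ → F)
        γ = subst (λ m → Geodesic F F m (λ _ → F))
                  (trans (sym (dis-refl F)) (dis-via-neighbour F F G FKG dKG dFG))
                  (Geodesic-refl (≻-facetˡ F≻G))
    neighbours⇒geodesicAbove neighbours (suc m) {F} {G} F≻G dFG
        | K , K≻G , dKG , FKG | inj₂ (inj₂ K≻F)
      with neighbours⇒geodesicAbove neighbours m K≻F
             (trans (dis-symᶠ (≻-facetˡ K≻G) (≻-facetˡ F≻G)) (dis-via-neighbour F K G FKG dKG dFG))
    ... | h , γ , above =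
      GeodesicAbove-snoc (Geodesic-reverse γ) (λ a _ → ≽-≻-trans (above (m ∸ a) (m∸n≤m m a)) F≻G)
                         K≻G dKG FKG

    GeodesicChain : Subset n → Subset n → Set
    GeodesicChain F G = ∃[ H ] (ChainBase Δ L F G H ×
      (∀ l₁ l₂ → l₁ Fin.≤ l₂ → dis (H l₁) (H l₂) ≡ toℕ l₂ ∸ toℕ l₁))

    geodesicAbove⇒chain : ∀ {F G} → GeodesicAbove F G (dis F G) → GeodesicChain F G
    geodesicAbove⇒chain {F} {G} (h , γ , above) =
      h ∘ toℕ ,
      (start γ , trans (cong h (Finₚ.toℕ-fromℕ (dis F G))) (end γ) ,
       (λ l → facet γ (toℕ l) (Finₚ.toℕ≤pred[n] l)) ,
       (λ l → above (toℕ l) (Finₚ.toℕ≤pred[n] l))) ,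
      (λ l₁ l₂ l₁≤l₂ → dis-h γ (toℕ l₁) (toℕ l₂) l₁≤l₂ (Finₚ.toℕ≤pred[n] l₂))

    neighbours⇒geodesicChains : HasNeighboursBetween → ∀ F G → F ≻[ L ] G → GeodesicChain F G
    neighbours⇒geodesicChains neighbours F G F≻G =
      geodesicAbove⇒chain (neighbours⇒geodesicAbove neighbours (dis F G) F≻G refl)

    ConclusionD : Subset n → Subset n → Set
    ConclusionD F G = dis F G ≡ 1 ⊎
      (2 ≤ dis F G × ∃[ H ] (H ≻[ L ] G × H ≢ F × dis F H + dis H G ≡ dis F G))

    ConclusionE : Subset n → Subset n → Set
    ConclusionE F G = dis F G ≡ 1 ⊎
      (2 ≤ dis F G × ∃[ H ] (H ≻[ L ] G × H ≢ F × F ∩ G ⊆ H × H ⊆ F ∪ G))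

    -- The second facet of a chain of dis F G unit steps from F to G is the required H.
    unitStepChain⇒conclusionD : ∀ {F G} t (H : Fin (suc t) → Subset n) → t ≡ dis F G → F ≻[ L ] G →
      H zero ≡ F → H (fromℕ t) ≡ G → (∀ l → H l ≽[ L ] G) →
      (∀ l → dis (H (inject₁ l)) (H (suc l)) ≡ 1) → ConclusionD F G
    unitStepChain⇒conclusionD zero _ t≡d F≻G _ _ _ _ = contradiction (sym t≡d) (≻⇒dis≢0 F≻G)
    unitStepChain⇒conclusionD (suc zero) _ t≡d _ _ _ _ _ = inj₁ (sym t≡d)
    unitStepChain⇒conclusionD (suc (suc t)) H t≡d _ refl refl above steps =
      inj₂ (subst (2 ≤_) t≡d (s≤s (s≤s z≤n)) , X , X≻G , X≢F ,
            trans (cong₂ _+_ (steps zero) dXG) t≡d)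
      where
        F = H zero
        G = H (fromℕ (suc (suc t)))
        X = H (suc zero)
        dXG : dis X G ≡ suc t
        dXG = ≤-antisym (unitSteps⇒dis≤length (suc t) (H ∘ suc) (steps ∘ suc))
                        (≤-pred (begin
                          suc (suc t)        ≡⟨ t≡d ⟩
                          dis F G            ≤⟨ dis-triangle F X G ⟩
                          dis F X + dis X G  ≡⟨ cong (_+ dis X G) (steps zero) ⟩
                          suc (dis X G)      ∎))
          where open ≤-Reasoning
        X≢F : X ≢ F
        X≢F = ≢-sym (dis≡suc⇒≢ F X (steps zero))
        X≻G : X ≻[ L ] G
        X≻G with above (suc zero)
        ... | inj₂ X≻G = X≻G
        ... | inj₁ X≡G = contradiction X≡G (dis≡suc⇒≢ X G dXG)

    conclusionD⇒conclusionE : ∀ {F G} → ConclusionD F G → ConclusionE F G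
    conclusionD⇒conclusionE (inj₁ d≡1) = inj₁ d≡1
    conclusionD⇒conclusionE {F} {G} (inj₂ (2≤d , H , H≻G , H≢F , additive)) =
      inj₂ (2≤d , H , H≻G , H≢F , Between⇒⊆ F H G (dis-additive⇒Between F H G additive))

    -- Replace F by the facet supplied by (e) until it is adjacent to G; dis to G strictly drops.
    conclusionsE⇒neighbours : (∀ F G → F ≻[ L ] G → ConclusionE F G) → HasNeighboursBetween
    conclusionsE⇒neighbours conclusion F G F≻G = search (dis F G) F≻G ≤-refl
      where
        search : ∀ bound {F G} → F ≻[ L ] G → dis F G ≤ bound → NeighbourBetween F G
        search zero F≻G d≤0 = contradiction (n≤0⇒n≡0 d≤0) (≻⇒dis≢0 F≻G)
        search (suc bound) {F} {G} F≻G d≤1+b with conclusion F G F≻G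
        ... | inj₁ d≡1 = F , F≻G , d≡1 , Between-reflˡ F G
        ... | inj₂ (_ , X , X≻G , X≢F , F∩G⊆X , X⊆F∪G)
          with search bound X≻G
                 (≤-pred (≤-trans (Between⇒dis<ᶠ (≻-facetˡ F≻G) (≻-facetˡ X≻G) X≢F
                                     (⊆⇒Between F X G F∩G⊆X X⊆F∪G)) d≤1+b))
        ...   | K , K≻G , dKG , XKG =
                K , K≻G , dKG , Between-innerTrans F X K G (⊆⇒Between F X G F∩G⊆X X⊆F∪G) XKG

  open Ordered

  StronglyShellable⇒CondC : StronglyShellable Δ → CondC Δ
  StronglyShellable⇒CondC (L , shelling@(fo , _)) =
    L , fo , neighbours⇒geodesicChains L fo (strongShelling⇒neighbours L fo shelling)

  CondC⇒CondB : CondC Δ → CondB Δ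
  CondC⇒CondB (L , fo , chains) = L , fo , λ F G F≻G →
    let (H , base , geodesic) = chains F G F≻G in H , base , geodesic⇒unitSteps H geodesic

  CondB⇒CondD : CondB Δ → CondD Δ
  CondB⇒CondD (L , fo , chains) = L , fo , λ F G F≻G →
    let (H , (H₀≡F , Hₜ≡G , _ , above) , steps) = chains F G F≻G
    in unitStepChain⇒conclusionD L fo (dis F G) H refl F≻G H₀≡F Hₜ≡G above steps

  CondD⇒CondE : CondD Δ → CondE Δ
  CondD⇒CondE (L , fo , conclusion) =
    L , fo , λ F G F≻G → conclusionD⇒conclusionE L fo (conclusion F G F≻G)

  CondE⇒StronglyShellable : CondE Δ → StronglyShellable Δ
  CondE⇒StronglyShellable (L , fo , conclusion) =
    L , neighbours⇒strongShelling L fo (conclusionsE⇒neighbours L fo conclusion)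

proposition4p3 : ∀ {n : ℕ} (Δ : Complex n) → Pure Δ →
    (StronglyShellable Δ ⇔ CondB Δ) × (StronglyShellable Δ ⇔ CondC Δ) ×
    (StronglyShellable Δ ⇔ CondD Δ) × (StronglyShellable Δ ⇔ CondE Δ)
proposition4p3 Δ pure = mk⇔ a⇒b b⇒a , mk⇔ a⇒c c⇒a , mk⇔ a⇒d d⇒a , mk⇔ a⇒e e⇒a
  where
    open PureComplex Δ pure

    a⇒c : StronglyShellable Δ → CondC Δ
    a⇒c = StronglyShellable⇒CondC

    e⇒a : CondE Δ → StronglyShellable Δ
    e⇒a = CondE⇒StronglyShellable

    a⇒b : StronglyShellable Δ → CondB Δ
    a⇒b = CondC⇒CondB ∘ a⇒c

    a⇒d : StronglyShellable Δ → CondD Δ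
    a⇒d = CondB⇒CondD ∘ a⇒b

    a⇒e : StronglyShellable Δ → CondE Δ
    a⇒e = CondD⇒CondE ∘ a⇒d

    d⇒a : CondD Δ → StronglyShellable Δ
    d⇒a = e⇒a ∘ CondD⇒CondE

    b⇒a : CondB Δ → StronglyShellable Δ
    b⇒a = d⇒a ∘ CondB⇒CondD

    c⇒a : CondC Δ → StronglyShellable Δ
    c⇒a = b⇒a ∘ CondC⇒CondB
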